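{- Fix a non-negative integer $t$. Let $T$ be a finite rooted tree such that for every root-to-leaf path $v_1,v_2,\ldots,v_q$ we have $\sum_{i=1}^{q} c(v_i) \le t$, where $c(v)$ denotes the number of children of node $v$. Then the maximum number of leaves that such a tree $T$ can have is $l(t)$, where $l(1)=1$ and for $t \neq 1$: $l(t)=3^i$ if $t=3i$, $l(t)=4\cdot 3^{i-1}$ if $t=3i+1$, and $l(t)=2\cdot 3^i$ if $t=3i+2$ (with $i$ a non-negative integer). -}

module Defs where

open import Data.Nat using (ℕ; zero; suc; _+_; _*_; _∸_; _^_; _≤_)
open import Data.Nat.DivMod using (_/_; _%_)
open import Data.List.Relation.Unary.All using (All)
open import Data.List using (List; []; _∷_; length; map; _++_)

data Tree : Set where
  node : List Tree → Tree

children : Tree → ℕ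
children (node ts) = length ts

mutual
  leaves : Tree → ℕ
  leaves (node []) = 1
  leaves (node (t ∷ ts)) = leavesList (t ∷ ts)

  leavesList : List Tree → ℕ
  leavesList [] = 0
  leavesList (t ∷ ts) = leaves t + leavesList ts

mutual
  -- for each root-to-leaf path v₁,…,v_q, the sum Σ c(vᵢ)
  pathCosts : Tree → List ℕ
  pathCosts (node []) = 0 ∷ []
  pathCosts (node (t ∷ ts)) = map (length (t ∷ ts) +_) (pathCostsList (t ∷ ts))

  pathCostsList : List Tree → List ℕ
  pathCostsList [] = []
  pathCostsList (t ∷ ts) = pathCosts t ++ pathCostsList ts


Admissible : ℕ → Tree → Set
Admissible t T = All (_≤ t) (pathCosts T)

lByRem : ℕ → ℕ → ℕ
lByRem i 0 = 3 ^ i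
lByRem i 1 = 4 * 3 ^ (i ∸ 1)
lByRem i _ = 2 * 3 ^ i

l : ℕ → ℕ
l 1 = 1
l t = lByRem (t / 3) (t % 3)

-- The function l satisfies l (t + 3) = 3 l t for t ≥ 2; ℓ below is l defined by this
-- recursion. If the root has k ≥ 1 children, every subtree is
-- admissible for t − k, so the tree has at most k ℓ (t − k) ≤ ℓ k ℓ (t − k) ≤ ℓ t
-- leaves, because n ≤ ℓ n and ℓ is supermultiplicative. Conversely, three copies of
-- an optimal tree for t under a new root give an optimal tree for t + 3.
module Submission where

open import Defs
open import Data.Nat using (ℕ; zero; suc; _+_; _*_; _∸_; _^_; _≤_; z≤n; s≤s; _≤?_)
open import Data.Nat.Properties
open import Algebra.Properties.CommutativeSemigroup *-commutativeSemigroup using (x∙yz≈y∙xz)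
open import Data.Nat.DivMod using (_/_; _%_; m/n≡1+[m∸n]/n; [m+n]%n≡m%n; m≥n⇒m/n>0)
open import Data.Product using (_×_; Σ; ∃; _,_)
open import Data.List using ([]; _∷_; length; replicate)
open import Data.List.Properties using (length-replicate)
open import Data.List.Relation.Unary.All as All using (All; []; _∷_)
open import Data.List.Relation.Unary.All.Properties using (map⁺; map⁻; ++⁺; ++⁻ˡ; ++⁻ʳ)
open import Relation.Binary.PropositionalEquality
open import Relation.Nullary.Decidable using (True; toWitness)

by-evaluation : ∀ {m n} {m≤n : True (m ≤? n)} → m ≤ n
by-evaluation {m≤n = m≤n} = toWitness m≤n

ℓ : ℕ → ℕ
ℓ 0 = 1
ℓ 1 = 1
ℓ 2 = 2
ℓ 3 = 3
ℓ 4 = 4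
ℓ (suc (suc (suc m@(suc (suc _))))) = 3 * ℓ m

-- The hypothesis excludes lByRem 0 1 = 4 · 3 ^ (0 ∸ 1) = 4, where the truncated
-- subtraction breaks the pattern.
lByRem-suc : ∀ i r → (r ≡ 1 → 1 ≤ i) → lByRem (suc i) r ≡ 3 * lByRem i r
lByRem-suc i       0             _   = refl
lByRem-suc zero    1             1≤0 with () ← 1≤0 refl
lByRem-suc (suc i) 1             _   = x∙yz≈y∙xz 4 3 (3 ^ i)
lByRem-suc i       (suc (suc _)) _   = x∙yz≈y∙xz 2 3 (3 ^ i)

[2+n]%3≡1⇒[2+n]/3>0 : ∀ n → (2 + n) % 3 ≡ 1 → 1 ≤ (2 + n) / 3
[2+n]%3≡1⇒[2+n]/3>0 0       ()
[2+n]%3≡1⇒[2+n]/3>0 (suc n) _ = m≥n⇒m/n>0 {3 + n} (s≤s (s≤s (s≤s z≤n)))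

l-step : ∀ n → l (5 + n) ≡ 3 * l (2 + n)
l-step n = begin
  lByRem ((3 + m) / 3) ((3 + m) % 3) ≡⟨ cong₂ lByRem (m/n≡1+[m∸n]/n {3 + m} (m≤m+n 3 m)) [3+m]%3≡m%3 ⟩
  lByRem (suc (m / 3)) (m % 3)       ≡⟨ lByRem-suc (m / 3) (m % 3) ([2+n]%3≡1⇒[2+n]/3>0 n) ⟩
  3 * lByRem (m / 3) (m % 3)         ∎
  where
  open ≡-Reasoning
  m = 2 + n
  [3+m]%3≡m%3 : (3 + m) % 3 ≡ m % 3
  [3+m]%3≡m%3 = trans (cong (_% 3) (+-comm 3 m)) ([m+n]%n≡m%n m 3)

l≡ℓ : ∀ t → l t ≡ ℓ t
l≡ℓ 0 = refl
l≡ℓ 1 = refl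
l≡ℓ 2 = refl
l≡ℓ 3 = refl
l≡ℓ 4 = refl
l≡ℓ (suc (suc (suc m@(suc (suc n))))) = trans (l-step n) (cong (3 *_) (l≡ℓ m))

n≤ℓ : ∀ n → n ≤ ℓ n
n≤ℓ 0 = z≤n
n≤ℓ 1 = by-evaluation
n≤ℓ 2 = by-evaluation
n≤ℓ 3 = by-evaluation
n≤ℓ 4 = by-evaluation
n≤ℓ (suc (suc (suc m@(suc (suc n))))) = begin
  5 + n       ≤⟨ +-monoˡ-≤ n (by-evaluation {5} {6}) ⟩
  6 + n       ≤⟨ +-monoʳ-≤ 6 (m≤n*m n 3) ⟩
  6 + 3 * n   ≡⟨ *-distribˡ-+ 3 2 n ⟨
  3 * (2 + n) ≤⟨ *-monoʳ-≤ 3 (n≤ℓ m) ⟩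
  3 * ℓ (2 + n) ∎
  where open ≤-Reasoning

1≤ℓ : ∀ n → 1 ≤ ℓ n
1≤ℓ 0       = by-evaluation
1≤ℓ (suc n) = ≤-trans (s≤s z≤n) (n≤ℓ (suc n))

ℓ[m+5+n]≡3ℓ[m+2+n] : ∀ m n → ℓ (m + (5 + n)) ≡ 3 * ℓ (m + (2 + n))
ℓ[m+5+n]≡3ℓ[m+2+n] m n
  rewrite +-suc m (4 + n) | +-suc m (3 + n) | +-suc m (2 + n) | +-suc m (1 + n) | +-suc m n = refl

ℓ-supermultiplicative : ∀ m n → ℓ m * ℓ n ≤ ℓ (m + n)
ℓ-supermultiplicative (suc (suc (suc m@(suc (suc _))))) n = begin
  3 * ℓ m * ℓ n   ≡⟨ *-assoc 3 (ℓ m) (ℓ n) ⟩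
  3 * (ℓ m * ℓ n) ≤⟨ *-monoʳ-≤ 3 (ℓ-supermultiplicative m n) ⟩
  3 * ℓ (m + n)   ∎
  where open ≤-Reasoning
ℓ-supermultiplicative m (suc (suc (suc n′@(suc (suc n))))) = begin
  ℓ m * (3 * ℓ (2 + n)) ≡⟨ x∙yz≈y∙xz (ℓ m) 3 (ℓ (2 + n)) ⟩
  3 * (ℓ m * ℓ (2 + n)) ≤⟨ *-monoʳ-≤ 3 (ℓ-supermultiplicative m n′) ⟩
  3 * ℓ (m + (2 + n))   ≡⟨ ℓ[m+5+n]≡3ℓ[m+2+n] m n ⟨
  ℓ (m + (5 + n))       ∎
  where open ≤-Reasoning
ℓ-supermultiplicative 0 0 = by-evaluation
ℓ-supermultiplicative 0 1 = by-evaluation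
ℓ-supermultiplicative 0 2 = by-evaluation
ℓ-supermultiplicative 0 3 = by-evaluation
ℓ-supermultiplicative 0 4 = by-evaluation
ℓ-supermultiplicative 1 0 = by-evaluation
ℓ-supermultiplicative 1 1 = by-evaluation
ℓ-supermultiplicative 1 2 = by-evaluation
ℓ-supermultiplicative 1 3 = by-evaluation
ℓ-supermultiplicative 1 4 = by-evaluation
ℓ-supermultiplicative 2 0 = by-evaluation
ℓ-supermultiplicative 2 1 = by-evaluation
ℓ-supermultiplicative 2 2 = by-evaluation
ℓ-supermultiplicative 2 3 = by-evaluation
ℓ-supermultiplicative 2 4 = by-evaluation
ℓ-supermultiplicative 3 0 = by-evaluation
ℓ-supermultiplicative 3 1 = by-evaluation
ℓ-supermultiplicative 3 2 = by-evaluation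
ℓ-supermultiplicative 3 3 = by-evaluation
ℓ-supermultiplicative 3 4 = by-evaluation
ℓ-supermultiplicative 4 0 = by-evaluation
ℓ-supermultiplicative 4 1 = by-evaluation
ℓ-supermultiplicative 4 2 = by-evaluation
ℓ-supermultiplicative 4 3 = by-evaluation
ℓ-supermultiplicative 4 4 = by-evaluation

some-pathCost : ∀ {P : ℕ → Set} T → All P (pathCosts T) → ∃ P
some-pathCost (node [])      (p ∷ []) = 0 , p
some-pathCost (node (t ∷ _)) ps
  with p , k+p∈P ← some-pathCost t (++⁻ˡ (pathCosts t) (map⁻ ps)) = _ , k+p∈P

children≤ : ∀ {t} ts → Admissible t (node ts) → length ts ≤ t
children≤ []      _   = z≤n
children≤ (u ∷ _) adm with p , k+p≤t ← some-pathCost u (++⁻ˡ (pathCosts u) (map⁻ adm)) =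
  ≤-trans (m≤m+n _ p) k+p≤t

subtrees-admissible : ∀ {t} ts → Admissible t (node ts) → All (_≤ t ∸ length ts) (pathCostsList ts)
subtrees-admissible []      _   = []
subtrees-admissible (u ∷ us) adm =
  All.map (λ {p} k+p≤t → subst (_≤ _) (m+n∸m≡n k p) (∸-monoˡ-≤ k k+p≤t)) (map⁻ adm)
  where k = length (u ∷ us)

mutual
  leaves≤ℓ : ∀ t T → Admissible t T → leaves T ≤ ℓ t
  leaves≤ℓ t (node [])         _   = 1≤ℓ t
  leaves≤ℓ t (node ts@(_ ∷ _)) adm = begin
    leavesList ts   ≤⟨ leavesList≤ (t ∸ k) ts (subtrees-admissible ts adm) ⟩
    k * ℓ (t ∸ k)   ≤⟨ *-monoˡ-≤ (ℓ (t ∸ k)) (n≤ℓ k) ⟩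
    ℓ k * ℓ (t ∸ k) ≤⟨ ℓ-supermultiplicative k (t ∸ k) ⟩
    ℓ (k + (t ∸ k)) ≡⟨ cong ℓ (m+[n∸m]≡n (children≤ ts adm)) ⟩
    ℓ t             ∎
    where
    open ≤-Reasoning
    k = length ts

  leavesList≤ : ∀ s ts → All (_≤ s) (pathCostsList ts) → leavesList ts ≤ length ts * ℓ s
  leavesList≤ s []       _   = z≤n
  leavesList≤ s (u ∷ us) adm =
    +-mono-≤ (leaves≤ℓ s u (++⁻ˡ (pathCosts u) adm)) (leavesList≤ s us (++⁻ʳ (pathCosts u) adm))

leaf : Tree
leaf = node []

fan : ℕ → Tree → Tree
fan k T = node (replicate k T)

leavesList-replicate : ∀ k T → leavesList (replicate k T) ≡ k * leaves T
leavesList-replicate zero    T = refl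
leavesList-replicate (suc k) T = cong (leaves T +_) (leavesList-replicate k T)

pathCostsList-replicate : ∀ {P : ℕ → Set} k T → All P (pathCosts T) → All P (pathCostsList (replicate k T))
pathCostsList-replicate zero    T ps = []
pathCostsList-replicate (suc k) T ps = ++⁺ ps (pathCostsList-replicate k T ps)

fan-admissible : ∀ k {s} T → Admissible s T → Admissible (suc k + s) (fan (suc k) T)
fan-admissible k {s} T adm = map⁺ (All.map shift (pathCostsList-replicate (suc k) T adm))
  where
  shift : ∀ {p} → p ≤ s → length (replicate (suc k) T) + p ≤ suc k + s
  shift {p} p≤s = subst (λ c → c + p ≤ suc k + s) (sym (length-replicate (suc k))) (+-monoʳ-≤ (suc k) p≤s)

optimal : ℕ → Tree
optimal 0 = leaf
optimal 1 = fan 1 leaf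
optimal 2 = fan 2 leaf
optimal 3 = fan 3 leaf
optimal 4 = fan 4 leaf
optimal (suc (suc (suc m@(suc (suc _))))) = fan 3 (optimal m)

optimal-admissible : ∀ t → Admissible t (optimal t)
optimal-admissible 0 = z≤n ∷ []
optimal-admissible 1 = fan-admissible 0 leaf (z≤n ∷ [])
optimal-admissible 2 = fan-admissible 1 leaf (z≤n ∷ [])
optimal-admissible 3 = fan-admissible 2 leaf (z≤n ∷ [])
optimal-admissible 4 = fan-admissible 3 leaf (z≤n ∷ [])
optimal-admissible (suc (suc (suc m@(suc (suc _))))) = fan-admissible 2 (optimal m) (optimal-admissible m)

leaves-optimal : ∀ t → leaves (optimal t) ≡ ℓ t
leaves-optimal 0 = refl
leaves-optimal 1 = refl
leaves-optimal 2 = refl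
leaves-optimal 3 = refl
leaves-optimal 4 = refl
leaves-optimal (suc (suc (suc m@(suc (suc _))))) =
  trans (leavesList-replicate 3 (optimal m)) (cong (3 *_) (leaves-optimal m))

lemma1 : (t : ℕ) →
    ((T : Tree) → Admissible t T → leaves T ≤ l t)
    × Σ Tree (λ T → Admissible t T × leaves T ≡ l t)
lemma1 t rewrite l≡ℓ t = leaves≤ℓ t , optimal t , optimal-admissible t , leaves-optimal t
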